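{- The image of the restriction $\alpha:\mathcal C(\mathbb Z)\to\mathbb Q^\times/\mathbb Q^{\times 2}$ consists exactly of the square classes $a\mathbb Q^{\times 2}$ for which there are integers $a,b$ with $ab=\Delta$ such that $ar^2-bs^2=4$ has an integral solution $(r,s)$.
   Context: Let $d$ be a squarefree integer with $d\neq 1$, and put $\Delta=d$ if $d\equiv 1\pmod 4$ and $\Delta=4d$ if $d\equiv 2,3\pmod 4$. Let $\mathcal C(\mathbb Z)=\{(x,y)\in\mathbb Z^2: x^2-\Delta y^2=4\}$. The map $\alpha$ is defined on $\mathcal C(\mathbb Q)=\{(x,y)\in\mathbb Q^2:x^2-\Delta y^2=4\}$ by $\alpha(x,y)=(x+2)\mathbb Q^{\times2}$ if $x\neq-2$ and $\alpha(-2,0)=-\Delta\,\mathbb Q^{\times2}$. -}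

module Defs where

open import Data.Nat using (ℕ)
open import Data.Integer as ℤ using (ℤ; +_; ∣_∣)
open import Data.Integer.DivMod using (_%_)
open import Data.Rational as ℚ using (ℚ; _/_; 0ℚ)
open import Data.Rational.Properties using () renaming (_≟_ to _≟ℚ_)
open import Data.Product using (Σ; ∃; _×_; _,_)
open import Relation.Binary.PropositionalEquality using (_≡_)
open import Relation.Nullary using (¬_; yes; no)

-- d is squarefree: the only natural n with n² ∣ |d| is n = 1 (this excludes d = 0).
SquareFree : ℤ → Set
SquareFree d = (n : ℕ) → (n Data.Nat.* n) Data.Nat.Divisibility.∣ ∣ d ∣ → n ≡ 1
  where import Data.Nat ; import Data.Nat.Divisibility

-- Δ = d if d ≡ 1 (mod 4), Δ = 4d otherwise (i.e. d ≡ 2,3 mod 4; d ≡ 0 is excluded by squarefreeness)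
Δ : ℤ → ℤ
Δ d with d % (+ 4)
... | 1 = d
... | _ = + 4 ℤ.* d

ι : ℤ → ℚ
ι n = n / 1

CZ : ℤ → ℤ → ℤ → Set
CZ D x y = x ℤ.* x ℤ.- D ℤ.* (y ℤ.* y) ≡ + 4

-- the map α on C(ℚ), valued in ℚ^× (a representative of the square class)
α : ℤ → ℚ → ℚ → ℚ
α D x y with x ≟ℚ ℚ.- ι (+ 2)
... | yes _ = ℚ.- ι D
... | no  _ = x ℚ.+ ι (+ 2)

SameSquareClass : ℚ → ℚ → Set
SameSquareClass p q = Σ ℚ λ t → ¬ (t ≡ 0ℚ) × p ≡ q ℚ.* (t ℚ.* t)

module Submission where

-- For an integral point (x, y) of x² − Δy² = 4 we have (x + 2)(x − 2) = Δy².  When the two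
-- factors are coprime (x odd), unique factorisation gives Δ = ab with x + 2 = ar² and
-- x − 2 = bs²; when x is even, one first removes the common powers of 2, and d ≡ 1 (mod 4),
-- resp. 4 ∤ d, rules out the parity patterns that cannot be split.  Then α(x, y) = ar² lies in
-- the class of a and ar² − bs² = 4.  Conversely a solution of ar² − bs² = 4 gives the point
-- (ar² − 2, rs), whose α-value is ar², or −Δ = a(2/s)² when ar² = 0.

open import Defs
open import Data.Integer as ℤ using (ℤ; +_)
open import Data.Rational as ℚ using (ℚ; 0ℚ)
open import Data.Product using (Σ; ∃; _×_; _,_)
open import Function.Bundles using (_⇔_)
open import Relation.Binary.PropositionalEquality using (_≡_)
open import Relation.Nullary using (¬_)

open import Data.Product using (∃₂)
open import Data.List using (_∷_; [])
open import Function using (_∘_)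
open import Relation.Binary.PropositionalEquality
  using (_≢_; refl; sym; trans; cong; cong₂; subst; subst₂; module ≡-Reasoning)
open import Relation.Nullary using (contradiction)

module ℕ-Factorisation where
  open import Data.Nat
  open import Data.Nat.Properties
  open import Data.Nat.Divisibility
  open import Data.Nat.GCD
  open import Data.Nat.Coprimality using (Coprime; Bézout-coprime; coprime-divisor)
  import Data.Nat.Coprimality as Coprime
  open import Data.Nat.Tactic.RingSolver using (solve)
  open import Data.Sum using (inj₁)
  open ≡-Reasoning

  coprime-cofactors : ∀ m n → m ≢ 0 →
                      ∃ λ g → ∃₂ λ a b → g ≢ 0 × m ≡ a * g × n ≡ b * g × Coprime a b
  coprime-cofactors m n m≢0 with gcd[m,n]∣m m n | gcd[m,n]∣n m n
  ... | divides a m≡ag | divides b n≡bg = gcd m n , a , b , g≢0 , m≡ag , n≡bg ,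
    Bézout-coprime {{≢-nonZero g≢0}}
      (subst₂ (Bézout.Identity (gcd m n)) m≡ag n≡bg (Bézout.identity (gcd-GCD m n)))
    where
    g≢0 : gcd m n ≢ 0
    g≢0 = gcd[m,n]≢0 m n (inj₁ m≢0)

  coprime-factor-of-square : ∀ {u v y} → Coprime u v → u * v ≡ y * y → u ≢ 0 →
                             ∃ λ m → u ≡ m * m × m ∣ y
  coprime-factor-of-square {u} {v} {y} u⊥v uv≡yy u≢0 with coprime-cofactors u y u≢0
  ... | g , m , n , g≢0 , u≡mg , y≡ng , m⊥n = square-from m∣g
    where
    instance _ = ≢-nonZero g≢0
    mv≡gnn : m * v ≡ g * (n * n)
    mv≡gnn = *-cancelˡ-≡ _ _ g (begin
      g * (m * v)       ≡⟨ solve (g ∷ m ∷ v ∷ []) ⟩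
      (m * g) * v       ≡⟨ cong (_* v) u≡mg ⟨
      u * v             ≡⟨ uv≡yy ⟩
      y * y             ≡⟨ cong₂ _*_ y≡ng y≡ng ⟩
      (n * g) * (n * g) ≡⟨ solve (g ∷ n ∷ []) ⟩
      g * (g * (n * n)) ∎)
    m∣g : m ∣ g
    m∣g = coprime-divisor m⊥n (coprime-divisor m⊥n (divides v (begin
      n * (n * g) ≡⟨ solve (n ∷ g ∷ []) ⟩
      g * (n * n) ≡⟨ mv≡gnn ⟨
      m * v       ≡⟨ *-comm m v ⟩
      v * m       ∎)))
    square-from : m ∣ g → ∃ λ m → u ≡ m * m × m ∣ y
    square-from (divides k g≡km) = m , u≡mm , divides (n * k) y≡nkm
      where
      instance _ = ≢-nonZero (λ m≡0 → u≢0 (trans u≡mg (cong (_* g) m≡0)))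
      u≡mmk : u ≡ (m * m) * k
      u≡mmk = trans u≡mg (trans (cong (m *_) g≡km) (solve (m ∷ k ∷ [])))
      v≡nnk : v ≡ (n * n) * k
      v≡nnk = *-cancelˡ-≡ _ _ m
                (trans mv≡gnn (trans (cong (_* (n * n)) g≡km) (solve (k ∷ m ∷ n ∷ []))))
      k≡1 : k ≡ 1
      k≡1 = u⊥v (divides (m * m) u≡mmk , divides (n * n) v≡nnk)
      u≡mm : u ≡ m * m
      u≡mm = trans u≡mmk (trans (cong ((m * m) *_) k≡1) (*-identityʳ (m * m)))
      y≡nkm : y ≡ (n * k) * m
      y≡nkm = trans y≡ng (trans (cong (n *_) g≡km) (solve (n ∷ k ∷ m ∷ [])))

  coprime-factor-of-multiple-of-square : ∀ {u v D y} → Coprime u v → u * v ≡ D * (y * y) →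
    u ≢ 0 → D ≢ 0 → ∃₂ λ A m → A ∣ D × m ∣ y × u ≡ A * (m * m)
  coprime-factor-of-multiple-of-square {u} {v} {D} {y} u⊥v uv≡Dyy u≢0 D≢0
    with coprime-cofactors u D u≢0
  ... | g , u′ , d′ , g≢0 , u≡u′g , D≡d′g , u′⊥d′ = from-divisor d′∣v
    where
    instance _ = ≢-nonZero g≢0
    u′v≡d′yy : u′ * v ≡ d′ * (y * y)
    u′v≡d′yy = *-cancelˡ-≡ _ _ g (begin
      g * (u′ * v)       ≡⟨ solve (g ∷ u′ ∷ v ∷ []) ⟩
      (u′ * g) * v       ≡⟨ cong (_* v) u≡u′g ⟨
      u * v              ≡⟨ uv≡Dyy ⟩
      D * (y * y)        ≡⟨ cong (_* (y * y)) D≡d′g ⟩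
      (d′ * g) * (y * y) ≡⟨ solve (d′ ∷ g ∷ y ∷ []) ⟩
      g * (d′ * (y * y)) ∎)
    d′∣v : d′ ∣ v
    d′∣v = coprime-divisor (Coprime.sym u′⊥d′)
             (divides (y * y) (trans u′v≡d′yy (*-comm d′ (y * y))))
    from-divisor : d′ ∣ v → ∃₂ λ A m → A ∣ D × m ∣ y × u ≡ A * (m * m)
    from-divisor (divides v′ v≡v′d′) = from-square (coprime-factor-of-square u′⊥v′ u′v′≡yy u′≢0)
      where
      instance _ = ≢-nonZero (λ d′≡0 → D≢0 (trans D≡d′g (cong (_* g) d′≡0)))
      u′v′≡yy : u′ * v′ ≡ y * y
      u′v′≡yy = *-cancelˡ-≡ _ _ d′ (begin
        d′ * (u′ * v′) ≡⟨ solve (d′ ∷ u′ ∷ v′ ∷ []) ⟩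
        u′ * (v′ * d′) ≡⟨ cong (u′ *_) v≡v′d′ ⟨
        u′ * v         ≡⟨ u′v≡d′yy ⟩
        d′ * (y * y)   ∎)
      u′⊥v′ : Coprime u′ v′
      u′⊥v′ (k∣u′ , k∣v′) = u⊥v (∣-trans k∣u′ (divides g (trans u≡u′g (*-comm u′ g))) ,
                                ∣-trans k∣v′ (divides d′ (trans v≡v′d′ (*-comm v′ d′))))
      u′≢0 : u′ ≢ 0
      u′≢0 u′≡0 = u≢0 (trans u≡u′g (cong (_* g) u′≡0))
      from-square : (∃ λ m → u′ ≡ m * m × m ∣ y) → ∃₂ λ A m → A ∣ D × m ∣ y × u ≡ A * (m * m)
      from-square (m , u′≡mm , m∣y) = g , m , divides d′ D≡d′g , m∣y ,
        trans u≡u′g (trans (cong (_* g) u′≡mm) (*-comm (m * m) g))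

module ℤ-Arithmetic where
  open import Data.Integer
  open import Data.Integer.Properties
  open import Data.Integer.DivMod using (_%_; _/_; n%d<d; a≡a%n+[a/n]*n)
  open import Data.Integer.Tactic.RingSolver using (solve)
  import Data.Nat as ℕ
  import Data.Nat.Properties as ℕ

  linear-combination : ∀ {A B P Q} → A ≡ B → ∀ c → P ≡ Q + c * (A - B) → P ≡ Q
  linear-combination {B = B} {Q = Q} refl c P≡ = trans P≡ (solve (Q ∷ c ∷ B ∷ []))

  data Parity : ℤ → Set where
    even : ∀ k → Parity (+ 2 * k)
    odd  : ∀ k → Parity (+ 2 * k + + 1)

  parity : ∀ z → Parity z
  parity z with z % + 2 | n%d<d z (+ 2) | a≡a%n+[a/n]*n z (+ 2)
  ... | 0 | _ | z≡0+q2 =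
    subst Parity (sym (trans z≡0+q2 (trans (+-identityˡ (q * + 2)) (*-comm q (+ 2))))) (even q)
    where
    q : ℤ
    q = z / + 2
  ... | 1 | _ | z≡1+q2 =
    subst Parity
      (sym (trans z≡1+q2 (trans (+-comm (+ 1) (q * + 2)) (cong (_+ + 1) (*-comm q (+ 2))))))
      (odd q)
    where
    q : ℤ
    q = z / + 2
  ... | ℕ.suc (ℕ.suc _) | ℕ.s≤s (ℕ.s≤s ()) | _

  odd≢even : ∀ k j → + 2 * k + + 1 ≢ + 2 * j
  odd≢even k j e =
    contradiction (ℕ.m*n≡1⇒m≡1 2 ∣ j - k ∣ (trans (sym (abs-* (+ 2) (j - k))) (cong ∣_∣ 2[j-k]≡1)))
                  λ ()
    where
    2[j-k]≡1 : + 2 * (j - k) ≡ + 1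
    2[j-k]≡1 = linear-combination e (- + 1) (solve (k ∷ j ∷ []))

  4*≢2 : ∀ k → + 4 * k ≢ + 2
  4*≢2 k e =
    odd≢even (+ 0) k
      (sym (*-cancelˡ-≡ (+ 2) (+ 2 * k) (+ 1) (trans (sym (*-assoc (+ 2) (+ 2) k)) e)))

  4q+1≢4w : ∀ q w → + 4 * q + + 1 ≢ + 4 * w
  4q+1≢4w q w e = odd≢even (+ 2 * q) (+ 2 * w) (linear-combination e (+ 1) (solve (q ∷ w ∷ [])))

module ℤ-Factorisation where
  open import Data.Integer
  open import Data.Integer.Properties
  open import Data.Integer.Coprimality using (Coprime)
  open import Data.Integer.Divisibility.Signed
    using (_∣_; divides; ∣ᵤ⇒∣; ∣⇒∣ᵤ; ∣m∣n⇒∣m+n; ∣n⇒∣m*n)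
  open import Data.Integer.Tactic.RingSolver using (solve)
  import Data.Nat as ℕ
  import Data.Nat.Divisibility as ℕ using (_∣_; ∣1⇒≡1)
  import Data.Nat.Coprimality as ℕ using (0-coprimeTo-m⇒m≡1)
  import Data.Sign as Sign
  import Data.Sign.Properties as Sign
  open import Relation.Nullary using (yes; no)
  open ℕ-Factorisation
  open ≡-Reasoning

  record SquareFactorisation (D U V : ℤ) : Set where
    constructor factorisation
    field
      a b r s : ℤ
      ab≡D    : a * b ≡ D
      U≡arr   : U ≡ a * (r * r)
      V≡bss   : V ≡ b * (s * s)

  bézout⇒coprime : ∀ U V α β → α * U + β * V ≡ + 1 → Coprime U V
  bézout⇒coprime U V α β e {k} (k∣U , k∣V) = ℕ.∣1⇒≡1 (subst (k ℕ.∣_) (cong ∣_∣ e)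
    (∣⇒∣ᵤ (∣m∣n⇒∣m+n (∣n⇒∣m*n α (∣ᵤ⇒∣ {+ k} k∣U)) (∣n⇒∣m*n β (∣ᵤ⇒∣ {+ k} k∣V)))))

  unit-factorisation : ∀ D {V} → ∣ V ∣ ≡ 1 → SquareFactorisation D 0ℤ V
  unit-factorisation D {+ 1} refl =
    factorisation D (+ 1) 0ℤ (+ 1) (*-identityʳ D) (sym (*-zeroʳ D)) refl
  unit-factorisation D { -[1+ 0 ]} refl =
    factorisation (- D) -1ℤ 0ℤ (+ 1) (solve (D ∷ [])) (sym (*-zeroʳ (- D))) refl

  cofactor-square : ∀ {U V a b r s} → U ≢ 0ℤ → U ≡ a * (r * r) →
                    U * V ≡ (b * a) * ((s * r) * (s * r)) → V ≡ b * (s * s)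
  cofactor-square {U} {V} {a} {b} {r} {s} U≢0 U≡arr UV≡ = *-cancelˡ-≡ U V (b * (s * s)) (begin
    U * V                         ≡⟨ UV≡ ⟩
    (b * a) * ((s * r) * (s * r)) ≡⟨ solve (a ∷ b ∷ r ∷ s ∷ []) ⟩
    (a * (r * r)) * (b * (s * s)) ≡⟨ cong (_* (b * (s * s))) U≡arr ⟨
    U * (b * (s * s))             ∎)
    where instance _ = ≢-nonZero U≢0

  coprime-factorisation : ∀ {U V D Y} → Coprime U V → U * V ≡ D * (Y * Y) → D ≢ 0ℤ →
                          SquareFactorisation D U V
  coprime-factorisation {U} {V} {D} {Y} U⊥V UV≡DYY D≢0 with U ≟ 0ℤ
  ... | yes refl = unit-factorisation D (ℕ.0-coprimeTo-m⇒m≡1 U⊥V)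
  ... | no U≢0 = from-ℕ (coprime-factor-of-multiple-of-square U⊥V ∣U∣∣V∣≡∣D∣∣Y∣∣Y∣
                           (U≢0 ∘ ∣i∣≡0⇒i≡0) (D≢0 ∘ ∣i∣≡0⇒i≡0))
    where
    ∣U∣∣V∣≡∣D∣∣Y∣∣Y∣ : ∣ U ∣ ℕ.* ∣ V ∣ ≡ ∣ D ∣ ℕ.* (∣ Y ∣ ℕ.* ∣ Y ∣)
    ∣U∣∣V∣≡∣D∣∣Y∣∣Y∣ = begin
      ∣ U ∣ ℕ.* ∣ V ∣             ≡⟨ abs-* U V ⟨
      ∣ U * V ∣                   ≡⟨ cong ∣_∣ UV≡DYY ⟩
      ∣ D * (Y * Y) ∣             ≡⟨ abs-* D (Y * Y) ⟩
      ∣ D ∣ ℕ.* ∣ Y * Y ∣         ≡⟨ cong (∣ D ∣ ℕ.*_) (abs-* Y Y) ⟩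
      ∣ D ∣ ℕ.* (∣ Y ∣ ℕ.* ∣ Y ∣) ∎
    from-ℕ : (∃₂ λ A m → A ℕ.∣ ∣ D ∣ × m ℕ.∣ ∣ Y ∣ × ∣ U ∣ ≡ A ℕ.* (m ℕ.* m)) →
             SquareFactorisation D U V
    from-ℕ (A , m , A∣∣D∣ , m∣∣Y∣ , ∣U∣≡Amm) =
      from-quotients (∣ᵤ⇒∣ {a} {D} a∣D) (∣ᵤ⇒∣ {+ m} {Y} m∣∣Y∣)
      where
      a : ℤ
      a = sign U ◃ A
      a∣D : ∣ a ∣ ℕ.∣ ∣ D ∣
      a∣D = subst (ℕ._∣ ∣ D ∣) (sym (abs-◃ (sign U) A)) A∣∣D∣
      U≡amm : U ≡ a * (+ m * + m)
      U≡amm = begin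
        U                                          ≡⟨ ◃-inverse U ⟨
        sign U ◃ ∣ U ∣                             ≡⟨ cong (sign U ◃_) ∣U∣≡Amm ⟩
        sign U ◃ (A ℕ.* (m ℕ.* m))                 ≡⟨ cong (_◃ _) (Sign.*-identityʳ (sign U)) ⟨
        (sign U Sign.* Sign.+) ◃ (A ℕ.* (m ℕ.* m)) ≡⟨ ◃-distrib-* (sign U) Sign.+ A (m ℕ.* m) ⟩
        a * (Sign.+ ◃ (m ℕ.* m))                   ≡⟨ cong (a *_) (trans (+◃n≡+n _) (pos-* m m)) ⟩
        a * (+ m * + m)                            ∎
      from-quotients : a ∣ D → + m ∣ Y → SquareFactorisation D U V
      from-quotients (divides b D≡ba) (divides s Y≡sm) =
        factorisation a b (+ m) s (trans (*-comm a b) (sym D≡ba)) U≡amm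
          (cofactor-square {a = a} {b} {+ m} {s} U≢0 U≡amm
            (trans UV≡DYY (cong₂ (λ d y → d * (y * y)) D≡ba Y≡sm)))

module Conic where
  open import Data.Integer
  open import Data.Integer.Properties
  open import Data.Integer.Coprimality using (Coprime)
  open import Data.Integer.DivMod using (_%_; _/_; a≡a%n+[a/n]*n)
  open import Data.Integer.Tactic.RingSolver using (solve)
  import Data.Nat as ℕ
  import Data.Nat.Properties as ℕ
  import Data.Nat.Divisibility as ℕ using (divides)
  open import Data.Empty using (⊥-elim)
  open ℤ-Arithmetic
  open ℤ-Factorisation

  squarefree⇒4∤ : ∀ {d} → SquareFree d → ∀ w → d ≢ + 4 * w
  squarefree⇒4∤ sf w refl =
    contradiction (sf 2 (ℕ.divides ∣ w ∣ (trans (abs-* (+ 4) w) (ℕ.*-comm 4 ∣ w ∣)))) λ ()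

  data DiscriminantShape (d : ℤ) : ℤ → Set where
    Δ≡d  : ∀ q → d ≡ + 4 * q + + 1 → DiscriminantShape d d
    Δ≡4d : DiscriminantShape d (+ 4 * d)

  discriminantShape : ∀ d → DiscriminantShape d (Δ d)
  discriminantShape d with d % + 4 | a≡a%n+[a/n]*n d (+ 4)
  ... | 0               | _ = Δ≡4d
  ... | 1               | d≡1+q4 =
    Δ≡d q (trans d≡1+q4 (trans (+-comm (+ 1) (q * + 4)) (cong (_+ + 1) (*-comm q (+ 4)))))
    where
    q : ℤ
    q = d / + 4
  ... | ℕ.suc (ℕ.suc _) | _ = Δ≡4d

  conic-factorisation-odd : ∀ {D y} k → let x = + 2 * k + + 1 in
    D ≢ 0ℤ → CZ D x y → SquareFactorisation D (x + + 2) (x - + 2)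
  conic-factorisation-odd {D} {y} k D≢0 cz = coprime-factorisation {Y = y} U⊥V UV≡Dyy D≢0
    where
    U⊥V : Coprime (+ 2 * k + + 1 + + 2) (+ 2 * k + + 1 - + 2)
    U⊥V = bézout⇒coprime (+ 2 * k + + 1 + + 2) (+ 2 * k + + 1 - + 2)
            (k * k) (- ((k + + 1) * (k + + 1))) (solve (k ∷ []))
    UV≡Dyy : (+ 2 * k + + 1 + + 2) * (+ 2 * k + + 1 - + 2) ≡ D * (y * y)
    UV≡Dyy = linear-combination cz (+ 1) (solve (k ∷ D ∷ y ∷ []))

  pell-factorisation-even : ∀ {d j} m → let k = + 2 * m in
    d ≢ 0ℤ → k * k - d * (j * j) ≡ + 1 → SquareFactorisation d (k + + 1) (k - + 1)
  pell-factorisation-even {d} {j} m d≢0 pell = coprime-factorisation {Y = j} U⊥V UV≡djj d≢0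
    where
    U⊥V : Coprime (+ 2 * m + + 1) (+ 2 * m - + 1)
    U⊥V = bézout⇒coprime (+ 2 * m + + 1) (+ 2 * m - + 1) (+ 1 - m) m (solve (m ∷ []))
    UV≡djj : (+ 2 * m + + 1) * (+ 2 * m - + 1) ≡ d * (j * j)
    UV≡djj = linear-combination pell (+ 1) (solve (m ∷ d ∷ j ∷ []))

  pell-factorisation-odd : ∀ {d j} m → let k = + 2 * m + + 1 in
    (∀ w → d ≢ + 4 * w) → k * k - d * (j * j) ≡ + 1 → SquareFactorisation d (m + + 1) m
  pell-factorisation-odd {d} {j} m 4∤d = by-parity (parity j)
    where
    by-parity : ∀ {j} → Parity j → (+ 2 * m + + 1) * (+ 2 * m + + 1) - d * (j * j) ≡ + 1 →
                SquareFactorisation d (m + + 1) m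
    by-parity (odd n) pell = ⊥-elim (4∤d (m * m + m - d * (n * n + n))
                                       (linear-combination pell (- + 1) (solve (m ∷ d ∷ n ∷ []))))
    by-parity (even n) pell = coprime-factorisation {Y = n} U⊥V UV≡dnn (4∤d (+ 0))
      where
      U⊥V : Coprime (m + + 1) m
      U⊥V = bézout⇒coprime (m + + 1) m (+ 1) (- + 1) (solve (m ∷ []))
      UV≡dnn : (m + + 1) * m ≡ d * (n * n)
      UV≡dnn = *-cancelˡ-≡ (+ 4) ((m + + 1) * m) (d * (n * n))
                 (linear-combination pell (+ 1) (solve (m ∷ d ∷ n ∷ [])))

  pell-1mod4-even≢1 : ∀ q m j → (+ 2 * m) * (+ 2 * m) - (+ 4 * q + + 1) * (j * j) ≢ + 1
  pell-1mod4-even≢1 q m j = by-parity (parity j)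
    where
    by-parity : ∀ {j} → Parity j → (+ 2 * m) * (+ 2 * m) - (+ 4 * q + + 1) * (j * j) ≢ + 1
    by-parity (even n) pell = odd≢even (+ 0) (+ 2 * (m * m) - + 2 * ((+ 4 * q + + 1) * (n * n)))
      (linear-combination pell (- + 1) (solve (q ∷ m ∷ n ∷ [])))
    by-parity (odd n) pell = 4*≢2 (m * m - (+ 4 * q + + 1) * (n * n + n) - q)
      (linear-combination pell (+ 1) (solve (q ∷ m ∷ n ∷ [])))

  conic-1mod4-even⇒pell : ∀ q k {y} → CZ (+ 4 * q + + 1) (+ 2 * k) y →
                          ∃ λ j → k * k - (+ 4 * q + + 1) * (j * j) ≡ + 1
  conic-1mod4-even⇒pell q k {y} = by-parity (parity y)
    where
    by-parity : ∀ {y} → Parity y → CZ (+ 4 * q + + 1) (+ 2 * k) y →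
                ∃ λ j → k * k - (+ 4 * q + + 1) * (j * j) ≡ + 1
    by-parity (odd j) cz = ⊥-elim (odd≢even
      (+ 2 * (k * k) - (+ 4 * q + + 1) * (+ 2 * (j * j + j)) - + 2 * q - + 1) (+ 2)
      (linear-combination cz (+ 1) (solve (q ∷ k ∷ j ∷ []))))
    by-parity (even j) cz = j , *-cancelˡ-≡ (+ 4) (k * k - (+ 4 * q + + 1) * (j * j)) (+ 1)
      (linear-combination cz (+ 1) (solve (q ∷ k ∷ j ∷ [])))

  double-factorisation : ∀ {d} k → SquareFactorisation d (k + + 1) (k - + 1) →
                         SquareFactorisation (+ 4 * d) (+ 2 * k + + 2) (+ 2 * k - + 2)
  double-factorisation {d} k (factorisation a b r s ab≡d U≡ V≡) =
    factorisation (+ 2 * a) (+ 2 * b) r s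
      (linear-combination ab≡d (+ 4) (solve (a ∷ b ∷ d ∷ [])))
      (linear-combination U≡ (+ 2) (solve (k ∷ a ∷ r ∷ [])))
      (linear-combination V≡ (+ 2) (solve (k ∷ b ∷ s ∷ [])))

  quadruple-factorisation : ∀ {d} m → SquareFactorisation d (m + + 1) m →
    SquareFactorisation d (+ 2 * (+ 2 * m + + 1) + + 2) (+ 2 * (+ 2 * m + + 1) - + 2)
  quadruple-factorisation {d} m (factorisation a b r s ab≡d U≡ V≡) =
    factorisation a b (+ 2 * r) (+ 2 * s) ab≡d
      (linear-combination U≡ (+ 4) (solve (m ∷ a ∷ r ∷ [])))
      (linear-combination V≡ (+ 4) (solve (m ∷ b ∷ s ∷ [])))

  quadruple-factorisation-4d : ∀ {d} m → SquareFactorisation d (m + + 1) m →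
    SquareFactorisation (+ 4 * d) (+ 2 * (+ 2 * m + + 1) + + 2) (+ 2 * (+ 2 * m + + 1) - + 2)
  quadruple-factorisation-4d {d} m (factorisation a b r s ab≡d U≡ V≡) =
    factorisation a (+ 4 * b) (+ 2 * r) s
      (linear-combination ab≡d (+ 4) (solve (a ∷ b ∷ d ∷ [])))
      (linear-combination U≡ (+ 4) (solve (m ∷ a ∷ r ∷ [])))
      (linear-combination V≡ (+ 4) (solve (m ∷ b ∷ s ∷ [])))

  conic-factorisation-1mod4 : ∀ q {x y} → CZ (+ 4 * q + + 1) x y →
                              SquareFactorisation (+ 4 * q + + 1) (x + + 2) (x - + 2)
  conic-factorisation-1mod4 q {x} {y} = by-parity (parity x)
    where
    from-pell : ∀ {k} → Parity k → (∃ λ j → k * k - (+ 4 * q + + 1) * (j * j) ≡ + 1) →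
                SquareFactorisation (+ 4 * q + + 1) (+ 2 * k + + 2) (+ 2 * k - + 2)
    from-pell (even m) (j , pell) = ⊥-elim (pell-1mod4-even≢1 q m j pell)
    from-pell (odd m)  (j , pell) =
      quadruple-factorisation m (pell-factorisation-odd {j = j} m (4q+1≢4w q) pell)
    by-parity : ∀ {x} → Parity x → CZ (+ 4 * q + + 1) x y →
                SquareFactorisation (+ 4 * q + + 1) (x + + 2) (x - + 2)
    by-parity (odd k)     = conic-factorisation-odd {y = y} k (4q+1≢4w q (+ 0))
    by-parity (even k) cz = from-pell (parity k) (conic-1mod4-even⇒pell q k {y} cz)

  conic-factorisation-4d : ∀ {d x y} → (∀ w → d ≢ + 4 * w) → CZ (+ 4 * d) x y →
                           SquareFactorisation (+ 4 * d) (x + + 2) (x - + 2)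
  conic-factorisation-4d {d} {x} {y} 4∤d = by-parity (parity x)
    where
    from-pell : ∀ {k} → Parity k → k * k - d * (y * y) ≡ + 1 →
                SquareFactorisation (+ 4 * d) (+ 2 * k + + 2) (+ 2 * k - + 2)
    from-pell (even m) pell =
      double-factorisation (+ 2 * m) (pell-factorisation-even {j = y} m (4∤d (+ 0)) pell)
    from-pell (odd m) pell =
      quadruple-factorisation-4d m (pell-factorisation-odd {j = y} m 4∤d pell)
    by-parity : ∀ {x} → Parity x → CZ (+ 4 * d) x y →
                SquareFactorisation (+ 4 * d) (x + + 2) (x - + 2)
    by-parity (odd k)     =
      conic-factorisation-odd {y = y} k (4∤d (+ 0) ∘ *-cancelˡ-≡ (+ 4) d (+ 0))
    by-parity (even k) cz = from-pell (parity k) (*-cancelˡ-≡ (+ 4) (k * k - d * (y * y)) (+ 1)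
                              (linear-combination cz (+ 1) (solve (k ∷ d ∷ y ∷ []))))

  conic-factorisation : ∀ {d D x y} → (∀ w → d ≢ + 4 * w) → DiscriminantShape d D → CZ D x y →
                        SquareFactorisation D (x + + 2) (x - + 2)
  conic-factorisation {x = x} {y} _   (Δ≡d q refl) = conic-factorisation-1mod4 q {x} {y}
  conic-factorisation {x = x} {y} 4∤d Δ≡4d         = conic-factorisation-4d {x = x} {y} 4∤d

module SquareClasses where
  open import Data.Integer as ℤ using (ℤ; +_; 0ℤ)
  import Data.Integer.Properties as ℤ
  open import Data.Rational using (ℚ; 0ℚ; 1ℚ; _+_; _*_; -_; 1/_; toℚᵘ; ≢-nonZero)
  open import Data.Rational.Properties
    using (toℚᵘ-injective; toℚᵘ-cong; toℚᵘ-fromℚᵘ; toℚᵘ-homo-+; toℚᵘ-homo-*; toℚᵘ-homo‿-;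
           *-inverseʳ; *-identityʳ; *-zeroˡ; *-zeroʳ; *-assoc; 1≢0; *-1-commutativeMonoid)
  open import Data.Rational.Unnormalised as ℚᵘ using (mkℚᵘ; *≡*)
  import Data.Rational.Unnormalised.Properties as ℚᵘ
  open import Algebra.Bundles using (CommutativeMonoid)
  open import Algebra.Properties.CommutativeSemigroup
    (CommutativeMonoid.commutativeSemigroup *-1-commutativeMonoid) using (interchange)
  open import Data.Product using (_,_)

  toℚᵘ-ι : ∀ n → toℚᵘ (ι n) ℚᵘ.≃ mkℚᵘ n 0
  toℚᵘ-ι n = toℚᵘ-fromℚᵘ (mkℚᵘ n 0)

  ι-injective : ∀ {m n} → ι m ≡ ι n → m ≡ n
  ι-injective {m} {n} ιm≡ιn = begin
    m           ≡⟨ ℤ.*-identityʳ m ⟨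
    m ℤ.* + 1   ≡⟨ ℚᵘ.drop-*≡* m≃n ⟩
    n ℤ.* + 1   ≡⟨ ℤ.*-identityʳ n ⟩
    n           ∎
    where
    open ≡-Reasoning
    m≃n : mkℚᵘ m 0 ℚᵘ.≃ mkℚᵘ n 0
    m≃n = ℚᵘ.≃-trans (ℚᵘ.≃-sym (toℚᵘ-ι m)) (ℚᵘ.≃-trans (toℚᵘ-cong ιm≡ιn) (toℚᵘ-ι n))

  ι-+ : ∀ m n → ι (m ℤ.+ n) ≡ ι m + ι n
  ι-+ m n = toℚᵘ-injective (begin
    toℚᵘ (ι (m ℤ.+ n))         ≈⟨ toℚᵘ-ι (m ℤ.+ n) ⟩
    mkℚᵘ (m ℤ.+ n) 0           ≈⟨ *≡* (cong (ℤ._* + 1) m*1+n*1≡m+n) ⟨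
    mkℚᵘ m 0 ℚᵘ.+ mkℚᵘ n 0     ≈⟨ ℚᵘ.+-cong (toℚᵘ-ι m) (toℚᵘ-ι n) ⟨
    toℚᵘ (ι m) ℚᵘ.+ toℚᵘ (ι n) ≈⟨ toℚᵘ-homo-+ (ι m) (ι n) ⟨
    toℚᵘ (ι m + ι n)           ∎)
    where
    open ℚᵘ.≃-Reasoning
    m*1+n*1≡m+n : m ℤ.* + 1 ℤ.+ n ℤ.* + 1 ≡ m ℤ.+ n
    m*1+n*1≡m+n = cong₂ ℤ._+_ (ℤ.*-identityʳ m) (ℤ.*-identityʳ n)

  ι-* : ∀ m n → ι (m ℤ.* n) ≡ ι m * ι n
  ι-* m n = toℚᵘ-injective (begin
    toℚᵘ (ι (m ℤ.* n))         ≈⟨ toℚᵘ-ι (m ℤ.* n) ⟩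
    mkℚᵘ (m ℤ.* n) 0           ≈⟨ *≡* refl ⟩
    mkℚᵘ m 0 ℚᵘ.* mkℚᵘ n 0     ≈⟨ ℚᵘ.*-cong (toℚᵘ-ι m) (toℚᵘ-ι n) ⟨
    toℚᵘ (ι m) ℚᵘ.* toℚᵘ (ι n) ≈⟨ toℚᵘ-homo-* (ι m) (ι n) ⟨
    toℚᵘ (ι m * ι n)           ∎)
    where open ℚᵘ.≃-Reasoning

  ι-neg : ∀ m → ι (ℤ.- m) ≡ - ι m
  ι-neg m = toℚᵘ-injective (begin
    toℚᵘ (ι (ℤ.- m))           ≈⟨ toℚᵘ-ι (ℤ.- m) ⟩
    mkℚᵘ (ℤ.- m) 0             ≈⟨ *≡* refl ⟩
    ℚᵘ.- mkℚᵘ m 0              ≈⟨ ℚᵘ.-‿cong (toℚᵘ-ι m) ⟨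
    ℚᵘ.- toℚᵘ (ι m)            ≈⟨ toℚᵘ-homo‿- (ι m) ⟨
    toℚᵘ (- ι m)               ∎)
    where open ℚᵘ.≃-Reasoning

  ι≢0 : ∀ {n} → n ≢ 0ℤ → ι n ≢ 0ℚ
  ι≢0 n≢0 ιn≡0 = n≢0 (ι-injective ιn≡0)

  *-≢0 : ∀ {p q} → p ≢ 0ℚ → q ≢ 0ℚ → p * q ≢ 0ℚ
  *-≢0 {p} {q} p≢0 q≢0 pq≡0 = p≢0 (begin
    p              ≡⟨ *-identityʳ p ⟨
    p * 1ℚ         ≡⟨ cong (p *_) (*-inverseʳ q) ⟨
    p * (q * 1/ q) ≡⟨ *-assoc p q (1/ q) ⟨
    (p * q) * 1/ q ≡⟨ cong (_* 1/ q) pq≡0 ⟩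
    0ℚ * 1/ q      ≡⟨ *-zeroˡ (1/ q) ⟩
    0ℚ             ∎)
    where
    open ≡-Reasoning
    instance _ = ≢-nonZero q≢0

  1/-≢0 : ∀ {p} (p≢0 : p ≢ 0ℚ) → (1/ p) {{≢-nonZero p≢0}} ≢ 0ℚ
  1/-≢0 {p} p≢0 1/p≡0 = 1≢0 (begin
    1ℚ        ≡⟨ *-inverseʳ p ⟨
    p * 1/ p  ≡⟨ cong (p *_) 1/p≡0 ⟩
    p * 0ℚ    ≡⟨ *-zeroʳ p ⟩
    0ℚ        ∎)
    where
    open ≡-Reasoning
    instance _ = ≢-nonZero p≢0

  *-square-assoc : ∀ p u w → (p * (u * u)) * (w * w) ≡ p * ((u * w) * (u * w))
  *-square-assoc p u w = trans (*-assoc p (u * u) (w * w)) (cong (p *_) (interchange u u w w))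

  sameSquareClass-trans : ∀ {p q r} → SameSquareClass p q → SameSquareClass q r →
                          SameSquareClass p r
  sameSquareClass-trans {p} {q} {r} (t , t≢0 , p≡qtt) (w , w≢0 , q≡rww) =
    w * t , *-≢0 w≢0 t≢0 , (begin
    p                       ≡⟨ p≡qtt ⟩
    q * (t * t)             ≡⟨ cong (_* (t * t)) q≡rww ⟩
    (r * (w * w)) * (t * t) ≡⟨ *-square-assoc r w t ⟩
    r * ((w * t) * (w * t)) ∎)
    where open ≡-Reasoning

  ι-sameSquareClass : ∀ m n u v → u ≢ 0ℤ → v ≢ 0ℤ → m ℤ.* (u ℤ.* u) ≡ n ℤ.* (v ℤ.* v) →
                      SameSquareClass (ι m) (ι n)
  ι-sameSquareClass m n u v u≢0 v≢0 muu≡nvv =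
    ι v * 1/ ι u , *-≢0 (ι≢0 v≢0) (1/-≢0 (ι≢0 u≢0)) , (begin
      ι m                                         ≡⟨ *-identityʳ (ι m) ⟨
      ι m * 1ℚ                                    ≡⟨ cong (λ t → ι m * (t * t)) (*-inverseʳ (ι u)) ⟨
      ι m * ((ι u * 1/ ι u) * (ι u * 1/ ι u))     ≡⟨ *-square-assoc (ι m) (ι u) (1/ ι u) ⟨
      (ι m * (ι u * ι u)) * (1/ ι u * 1/ ι u)     ≡⟨ cong (_* (1/ ι u * 1/ ι u)) (ι-*-square m u) ⟨
      ι (m ℤ.* (u ℤ.* u)) * (1/ ι u * 1/ ι u)     ≡⟨ cong (λ t → ι t * (1/ ι u * 1/ ι u)) muu≡nvv ⟩
      ι (n ℤ.* (v ℤ.* v)) * (1/ ι u * 1/ ι u)     ≡⟨ cong (_* (1/ ι u * 1/ ι u)) (ι-*-square n v) ⟩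
      (ι n * (ι v * ι v)) * (1/ ι u * 1/ ι u)     ≡⟨ *-square-assoc (ι n) (ι v) (1/ ι u) ⟩
      ι n * ((ι v * 1/ ι u) * (ι v * 1/ ι u))     ∎)
    where
    open ≡-Reasoning
    instance _ = ≢-nonZero (ι≢0 u≢0)
    ι-*-square : ∀ m u → ι (m ℤ.* (u ℤ.* u)) ≡ ι m * (ι u * ι u)
    ι-*-square m u = trans (ι-* m (u ℤ.* u)) (cong (ι m *_) (ι-* u u))

open import Data.Integer using (0ℤ; -1ℤ)
import Data.Integer.Properties as ℤ
open import Data.Integer.Tactic.RingSolver using (solve)
open import Data.Rational.Properties using (_≟_)
open import Data.Empty using (⊥-elim)
open import Relation.Nullary using (Dec; yes; no)
open import Function.Bundles using (mk⇔)
open ℤ-Factorisation using (SquareFactorisation; factorisation)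
open ℤ-Arithmetic using (linear-combination)
open Conic using (squarefree⇒4∤; DiscriminantShape; discriminantShape; conic-factorisation)
open SquareClasses using (ι-injective; ι-+; ι-neg; sameSquareClass-trans; ι-sameSquareClass)

α-ι : ∀ D {x} q → x ≢ ℤ.- + 2 → α D (ι x) q ≡ ι (x ℤ.+ + 2)
α-ι D {x} q x≢-2 with ι x ≟ ℚ.- ι (+ 2)
... | yes ιx≡-2 = ⊥-elim (x≢-2 (ι-injective ιx≡-2))
... | no _      = sym (ι-+ x (+ 2))

α-ι-−2 : ∀ D {x} q → x ≡ ℤ.- + 2 → α D (ι x) q ≡ ι (ℤ.- D)
α-ι-−2 D q refl = sym (ι-neg D)

square-factor-≢0 : ∀ {P} Q s → P ≡ Q ℤ.* (s ℤ.* s) → P ≢ 0ℤ → s ≢ 0ℤ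
square-factor-≢0 Q _ P≡Qss P≢0 refl = P≢0 (trans P≡Qss (ℤ.*-zeroʳ Q))

InImageOfα : ℤ → ℚ → Set
InImageOfα D c = Σ ℤ λ x → Σ ℤ λ y → CZ D x y × SameSquareClass (α D (ι x) (ι y)) c

HasSplitting : ℤ → ℚ → Set
HasSplitting D c = Σ ℤ λ a → Σ ℤ λ b → a ℤ.* b ≡ D × SameSquareClass (ι a) c ×
                     (Σ ℤ λ r → Σ ℤ λ s → a ℤ.* (r ℤ.* r) ℤ.- b ℤ.* (s ℤ.* s) ≡ + 4)

image⇒splitting : ∀ {d D c} → (∀ w → d ≢ + 4 ℤ.* w) → DiscriminantShape d D →
                  InImageOfα D c → HasSplitting D c
image⇒splitting {D = D} {c} 4∤d shape (x , y , cz , αx~c) = by-cases (x ℤ.≟ ℤ.- + 2)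
  where
  by-cases : Dec (x ≡ ℤ.- + 2) → HasSplitting D c
  by-cases (yes x≡-2) =
    ℤ.- D , -1ℤ , solve (D ∷ []) , subst (λ p → SameSquareClass p c) (α-ι-−2 D (ι y) x≡-2) αx~c ,
    0ℤ , + 2 , solve (D ∷ [])
  by-cases (no x≢-2) = from-factorisation (conic-factorisation {x = x} {y} 4∤d shape cz)
    where
    from-factorisation : SquareFactorisation D (x ℤ.+ + 2) (x ℤ.- + 2) → HasSplitting D c
    from-factorisation (factorisation a b r s ab≡D x+2≡arr x-2≡bss) =
      a , b , ab≡D , sameSquareClass-trans {r = c} a~x+2 x+2~c , r , s , arr-bss≡4
      where
      x+2≢0 : x ℤ.+ + 2 ≢ 0ℤ
      x+2≢0 x+2≡0 = x≢-2 (linear-combination x+2≡0 (+ 1) (solve (x ∷ [])))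
      a~x+2 : SameSquareClass (ι a) (ι (x ℤ.+ + 2))
      a~x+2 = ι-sameSquareClass a (x ℤ.+ + 2) r (+ 1) (square-factor-≢0 a r x+2≡arr x+2≢0) (λ ())
                (trans (sym x+2≡arr) (sym (ℤ.*-identityʳ (x ℤ.+ + 2))))
      x+2~c : SameSquareClass (ι (x ℤ.+ + 2)) c
      x+2~c = subst (λ p → SameSquareClass p c) (α-ι D (ι y) x≢-2) αx~c
      arr-bss≡4 : a ℤ.* (r ℤ.* r) ℤ.- b ℤ.* (s ℤ.* s) ≡ + 4
      arr-bss≡4 = begin
        a ℤ.* (r ℤ.* r) ℤ.- b ℤ.* (s ℤ.* s) ≡⟨ cong₂ ℤ._-_ x+2≡arr x-2≡bss ⟨
        (x ℤ.+ + 2) ℤ.- (x ℤ.- + 2)         ≡⟨ solve (x ∷ []) ⟩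
        + 4                                 ∎
        where open ≡-Reasoning

splitting⇒image : ∀ {D c} → HasSplitting D c → InImageOfα D c
splitting⇒image {c = c} (a , b , refl , a~c , r , s , arr-bss≡4) =
  a ℤ.* (r ℤ.* r) ℤ.- + 2 , r ℤ.* s , cz , by-cases (a ℤ.* (r ℤ.* r) ℤ.≟ 0ℤ)
  where
  cz : CZ (a ℤ.* b) (a ℤ.* (r ℤ.* r) ℤ.- + 2) (r ℤ.* s)
  cz = linear-combination arr-bss≡4 (a ℤ.* (r ℤ.* r)) (solve (a ∷ b ∷ r ∷ s ∷ []))
  by-cases : Dec (a ℤ.* (r ℤ.* r) ≡ 0ℤ) →
             SameSquareClass (α (a ℤ.* b) (ι (a ℤ.* (r ℤ.* r) ℤ.- + 2)) (ι (r ℤ.* s))) c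
  by-cases (yes arr≡0) =
    subst (λ p → SameSquareClass p c) (sym (α-ι-−2 (a ℤ.* b) (ι (r ℤ.* s)) (cong (ℤ._- + 2) arr≡0)))
      (sameSquareClass-trans {r = c} -ab~a a~c)
    where
    -bss≡4 : 0ℤ ℤ.- b ℤ.* (s ℤ.* s) ≡ + 4
    -bss≡4 = subst (λ t → t ℤ.- b ℤ.* (s ℤ.* s) ≡ + 4) arr≡0 arr-bss≡4
    4≡-bss : + 4 ≡ ℤ.- b ℤ.* (s ℤ.* s)
    4≡-bss = linear-combination -bss≡4 (ℤ.- + 1) (solve (b ∷ s ∷ []))
    -ab~a : SameSquareClass (ι (ℤ.- (a ℤ.* b))) (ι a)
    -ab~a = ι-sameSquareClass (ℤ.- (a ℤ.* b)) a s (+ 2)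
              (square-factor-≢0 (ℤ.- b) s 4≡-bss (λ ())) (λ ())
              (linear-combination -bss≡4 a (solve (a ∷ b ∷ s ∷ [])))
  by-cases (no arr≢0) =
    subst (λ p → SameSquareClass p c) (sym (α-ι (a ℤ.* b) (ι (r ℤ.* s)) x≢-2))
      (sameSquareClass-trans {r = c} x+2~a a~c)
    where
    x≢-2 : a ℤ.* (r ℤ.* r) ℤ.- + 2 ≢ ℤ.- + 2
    x≢-2 x≡-2 = arr≢0 (linear-combination x≡-2 (+ 1) (solve (a ∷ r ∷ [])))
    x+2~a : SameSquareClass (ι (a ℤ.* (r ℤ.* r) ℤ.- + 2 ℤ.+ + 2)) (ι a)
    x+2~a = ι-sameSquareClass (a ℤ.* (r ℤ.* r) ℤ.- + 2 ℤ.+ + 2) a (+ 1) r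
              (λ ()) (square-factor-≢0 a r refl arr≢0) (solve (a ∷ r ∷ []))

proposition3p5 : (d : ℤ) → SquareFree d → ¬ (d ≡ + 1) →
    (c : ℚ) → ¬ (c ≡ 0ℚ) →
      (Σ ℤ λ x → Σ ℤ λ y → CZ (Δ d) x y × SameSquareClass (α (Δ d) (ι x) (ι y)) c)
      ⇔
      (Σ ℤ λ a → Σ ℤ λ b → a ℤ.* b ≡ Δ d × SameSquareClass (ι a) c ×
         (Σ ℤ λ r → Σ ℤ λ s → a ℤ.* (r ℤ.* r) ℤ.- b ℤ.* (s ℤ.* s) ≡ + 4))
proposition3p5 d squarefree _ c _ =
  mk⇔ (image⇒splitting {c = c} (squarefree⇒4∤ squarefree) (discriminantShape d))
      (splitting⇒image {c = c})
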